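{- Let $k\ge2$ and let $p\in S_k$ be a permutation in which the letter $k$ is immediately followed by the letter $1$; let $j=p^{ -1}(k)$ be the index of $k$ in $p$. If a permutation $\pi\in S_n$ avoids the bivincular pattern $(p,\{j\},\emptyset)$, then $\pi$ also avoids the bivincular pattern $(p,\emptyset,\{2,3,\dots,k-2\})$.
   Context: A bivincular pattern is a triple $(p,X,Y)$ with $p\in S_k$ and $X,Y\subseteq\{0,\dots,k\}$. An occurrence of $(p,X,Y)$ in $\pi\in S_n$ is a subsequence $\pi_{i_1}\cdots\pi_{i_k}$ ($i_1<\dots<i_k$) whose letters are in the same relative order as those of $p$, such that $i_{x+1}=i_x+1$ for all $x\in X$ and $j_{y+1}=j_y+1$ for all $y\in Y$, where $j_1<\dots<j_k$ are the values of the subsequence in increasing order (conventions $i_0=j_0=0$, $i_{k+1}=j_{k+1}=n+1$). $\pi$ avoids the pattern if there is no occurrence. (The set $\{2,\dots,k-2\}$ is empty when $k\le3$.) -}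

module Defs where

open import Data.Nat as ℕ using (ℕ; zero; suc; _∸_; _≤?_; _<?_)
open import Data.Fin as Fin using (Fin; toℕ; fromℕ<)
open import Data.Fin.Permutation using (Permutation′; _⟨$⟩ʳ_; _⟨$⟩ˡ_) public
open import Data.Fin.Subset using (Subset; _∈_; ⁅_⁆; inside; outside) renaming (⊥ to ∅) public
open import Data.Vec using (tabulate)
open import Data.Bool using (if_then_else_; _∧_)
open import Data.Product using (Σ; _×_)
open import Relation.Binary.PropositionalEquality using (_≡_)
open import Relation.Nullary using (¬_; yes; no; ⌊_⌋)

-- Permutations of [n] are bijections Fin n ↔ Fin n (0-based letters/positions).
Perm : ℕ → Set
Perm n = Permutation′ n

-- A bivincular pattern (p, X, Y) with p ∈ S_k and X, Y ⊆ {0,…,k}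
-- (Fin (suc k) represents {0,…,k}).
record Bivincular (k : ℕ) : Set where
  constructor ⟨_,_,_⟩
  field
    pat : Perm k
    X   : Subset (suc k)
    Y   : Subset (suc k)

-- 1-based positions i_x of an occurrence given by the index map ι : Fin k → Fin n,
-- with conventions i_0 = 0 and i_{k+1} = n+1.
pos : ∀ {n k} → (Fin k → Fin n) → ℕ → ℕ
pos ι zero = 0
pos {n} {k} ι (suc x) with x <? k
... | yes x<k = suc (toℕ (ι (fromℕ< x<k)))
... | no _    = suc n

-- 1-based values j_y of the occurrence, listed in increasing order, with
-- j_0 = 0 and j_{k+1} = n+1.  Since the subsequence is order-isomorphic to p,
-- the y-th smallest value sits at pattern position p⁻¹(y).
val : ∀ {n k} → Perm n → Perm k → (Fin k → Fin n) → ℕ → ℕ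
val π p ι zero = 0
val {n} {k} π p ι (suc y) with y <? k
... | yes y<k = suc (toℕ (π ⟨$⟩ʳ ι (p ⟨$⟩ˡ fromℕ< y<k)))
... | no _    = suc n

record IsOccurrence {n k : ℕ} (P : Bivincular k) (π : Perm n) (ι : Fin k → Fin n) : Set where
  open Bivincular P
  field
    increasing : ∀ a b → a Fin.< b → ι a Fin.< ι b
    order-iso  : ∀ a b → (π ⟨$⟩ʳ ι a Fin.< π ⟨$⟩ʳ ι b → pat ⟨$⟩ʳ a Fin.< pat ⟨$⟩ʳ b)
                       × (pat ⟨$⟩ʳ a Fin.< pat ⟨$⟩ʳ b → π ⟨$⟩ʳ ι a Fin.< π ⟨$⟩ʳ ι b)
    adjX       : ∀ x → x ∈ X → pos ι (suc (toℕ x)) ≡ suc (pos ι (toℕ x))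
    adjY       : ∀ y → y ∈ Y → val π pat ι (suc (toℕ y)) ≡ suc (val π pat ι (toℕ y))

Avoids : ∀ {n k} → Perm n → Bivincular k → Set
Avoids {n} π P = ¬ Σ (Fin _ → Fin n) (IsOccurrence P π)

middle : (k : ℕ) → Subset (suc k)
middle k = tabulate (λ y → if ⌊ 2 ≤? toℕ y ⌋ ∧ ⌊ toℕ y ≤? k ∸ 2 ⌋ then inside else outside)

-- Let ι be an occurrence of (p, ∅, {2,…,k−2}) in π, and let a < b be the positions of π
-- matched to the letters k and 1 of p. The vincular conditions on values say that the
-- values of the inner letters 2,…,k−1 form a block [L, U] of consecutive integers.
-- Walking from position a to position b, the values of π fall from π(a) ≥ L to π(b) < L, so
-- there is a descent c, c+1 (a ≤ c < b) with π(c) ≥ L > π(c+1). A position strictly between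
-- a and b is not used by ι, so its value is not in [L, U]; hence π(c) > U (or c = a).
-- Matching k and 1 to c and c+1 instead of a and b gives an occurrence of (p, {j}, ∅).
module Submission where

open import Defs
open import Data.Nat using (ℕ; _≤_; _∸_; suc)
open import Data.Fin using (Fin; toℕ; suc)
open import Relation.Binary.PropositionalEquality using (_≡_)

open import Data.Nat as ℕ using (zero; _+_; _<_; _≟_; _≤?_; _<?_; z≤n; s≤s)
open import Data.Nat.Properties
open import Data.Fin as Fin using (fromℕ<; zero)
open import Data.Fin.Properties using (toℕ-injective; toℕ-fromℕ<; fromℕ<-toℕ; toℕ<n)
open import Data.Fin.Permutation using (inverseˡ; inverseʳ)
open import Data.Fin.Subset.Properties using (x∈⁅y⁆⇒x≡y; ∉⊥)
open import Data.Vec.Properties using (lookup∘tabulate; lookup⇒[]=)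
open import Data.Vec.Functional using (updateAt)
open import Data.Vec.Functional.Properties using (updateAt-updates; updateAt-minimal)
open import Data.Bool using (Bool; if_then_else_; _∧_)
open import Data.Product using (∃-syntax; _×_; _,_; proj₁; proj₂)
open import Data.Sum using (inj₁; inj₂)
open import Function using (_∘_; const)
open import Relation.Nullary using (Dec; yes; no; ⌊_⌋; contradiction)
open import Relation.Binary using (tri<; tri≈; tri>)
open import Relation.Binary.PropositionalEquality
  using (_≢_; refl; sym; trans; cong; subst; subst₂; module ≡-Reasoning)

crossing : (f : ℕ → ℕ) {L a : ℕ} → ∀ b → a ≤ b → L ≤ f a → f b < L
         → ∃[ c ] a ≤ c × c < b × L ≤ f c × f (suc c) < L
crossing f zero z≤n L≤fa fb<L = contradiction L≤fa (<⇒≱ fb<L)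
crossing f {L} (suc b) a≤1+b L≤fa f[1+b]<L with m≤n⇒m<n∨m≡n a≤1+b
... | inj₂ refl = contradiction L≤fa (<⇒≱ f[1+b]<L)
... | inj₁ (s≤s a≤b) with L ≤? f b
...   | yes L≤fb = b , a≤b , ≤-refl , L≤fb , f[1+b]<L
...   | no L≰fb with crossing f b a≤b L≤fa (≰⇒> L≰fb)
...     | c , a≤c , c<b , L≤fc , f[1+c]<L = c , a≤c , m<n⇒m<1+n c<b , L≤fc , f[1+c]<L

run-covers : (f : ℕ → ℕ) {lo : ℕ} → ∀ hi → lo ≤ hi
           → (∀ r → lo ≤ r → r < hi → f (suc r) ≡ suc (f r))
           → ∀ {v} → f lo ≤ v → v ≤ f hi → ∃[ r ] r ≤ hi × f r ≡ v
run-covers f zero z≤n _ f0≤v v≤f0 = zero , z≤n , ≤-antisym f0≤v v≤f0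
run-covers f (suc hi) lo≤1+hi step {v} flo≤v v≤f[1+hi]
  with m≤n⇒m<n∨m≡n lo≤1+hi | v ≟ f (suc hi)
... | inj₂ refl       | _        = suc hi , ≤-refl , ≤-antisym flo≤v v≤f[1+hi]
... | inj₁ _          | yes refl = suc hi , ≤-refl , refl
... | inj₁ (s≤s lo≤hi) | no v≢f[1+hi]
  with run-covers f hi lo≤hi (λ r lo≤r r<hi → step r lo≤r (m<n⇒m<1+n r<hi)) flo≤v v≤fhi
  where
    v≤fhi : v ≤ f hi
    v≤fhi = ≤-pred (subst (v <_) (step hi lo≤hi ≤-refl) (≤∧≢⇒< v≤f[1+hi] v≢f[1+hi]))
...   | r , r≤hi , fr≡v = r , m≤n⇒m≤1+n r≤hi , fr≡v

<-preserving⇒<-reflecting : {A : Set} (P g : A → ℕ) → (∀ {t u} → P t ≡ P u → t ≡ u)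
  → (∀ t u → P t < P u → g t < g u) → ∀ t u → g t < g u → P t < P u
<-preserving⇒<-reflecting P g P-injective preserving t u gt<gu with <-cmp (P t) (P u)
... | tri< Pt<Pu _ _ = Pt<Pu
... | tri≈ _ Pt≡Pu _ = contradiction (subst (λ s → g t < g s) (sym (P-injective Pt≡Pu)) gt<gu) (<-irrefl refl)
... | tri> _ _ Pu<Pt = contradiction gt<gu (<-asym (preserving u t Pu<Pt))

replace-extremes-preserving : ∀ {k} (P f g : Fin k → ℕ) {j j′ : Fin k}
  → (∀ t → P t ≤ P j) → (∀ t → P j′ ≤ P t)
  → (∀ t u → P t < P u → f t < f u)
  → (∀ t → t ≢ j → t ≢ j′ → g t ≡ f t)
  → g j′ < g j
  → (∀ t → t ≢ j → t ≢ j′ → g j′ < g t × g t < g j)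
  → ∀ t u → P t < P u → g t < g u
replace-extremes-preserving P f g {j} {j′} P≤Pj Pj′≤P f-preserving agrees gj′<gj inner t u Pt<Pu
  with u Fin.≟ j | t Fin.≟ j′
... | yes refl | yes refl = gj′<gj
... | yes refl | no t≢j′  = proj₂ (inner t (λ { refl → <-irrefl refl Pt<Pu }) t≢j′)
... | no u≢j   | yes refl = proj₁ (inner u u≢j (λ { refl → <-irrefl refl Pt<Pu }))
... | no u≢j   | no t≢j′  =
  subst₂ _<_ (sym (agrees t t≢j t≢j′)) (sym (agrees u u≢j u≢j′)) (f-preserving t u Pt<Pu)
  where
    t≢j : t ≢ j
    t≢j refl = <⇒≱ Pt<Pu (P≤Pj u)
    u≢j′ : u ≢ j′
    u≢j′ refl = <⇒≱ Pt<Pu (Pj′≤P t)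

module _ {k n : ℕ} {ι : Fin k → Fin n} (ι-increasing : ∀ t u → t Fin.< u → ι t Fin.< ι u) where

  increasing⇒monotone : ∀ {t u} → t Fin.≤ u → ι t Fin.≤ ι u
  increasing⇒monotone {t} {u} t≤u with m≤n⇒m<n∨m≡n t≤u
  ... | inj₁ t<u = <⇒≤ (ι-increasing t u t<u)
  ... | inj₂ t≡u = ≤-reflexive (cong (toℕ ∘ ι) (toℕ-injective t≡u))

  module _ {j j′ : Fin k} (j′≡1+j : toℕ j′ ≡ suc (toℕ j)) where

    increasing-adjacent-gap : ∀ s → ι j Fin.< ι s → ι j′ Fin.≤ ι s
    increasing-adjacent-gap s ιj<ιs with <-cmp (toℕ s) (toℕ j)
    ... | tri< s<j _ _ = contradiction ιj<ιs (<-asym (ι-increasing s j s<j))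
    ... | tri≈ _ s≡j _ = contradiction (subst (λ x → ι j Fin.< ι x) (toℕ-injective s≡j) ιj<ιs) (<-irrefl refl)
    ... | tri> _ _ j<s = increasing⇒monotone (subst (_≤ toℕ s) (sym j′≡1+j) j<s)

    replace-adjacent-increasing : {ι′ : Fin k → Fin n}
      → (∀ t → t ≢ j → t ≢ j′ → ι′ t ≡ ι t)
      → ι j Fin.≤ ι′ j → ι′ j Fin.< ι′ j′ → ι′ j′ Fin.≤ ι j′
      → ∀ t u → t Fin.< u → ι′ t Fin.< ι′ u
    replace-adjacent-increasing {ι′} agrees ιj≤ι′j ι′j<ι′j′ ι′j′≤ιj′ = increasing
      where
        lowered : ∀ s → s ≢ j → ι′ s Fin.≤ ι s
        lowered s s≢j with s Fin.≟ j′
        ... | yes refl = ι′j′≤ιj′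
        ... | no s≢j′  = ≤-reflexive (cong toℕ (agrees s s≢j s≢j′))

        raised : ∀ s → s ≢ j′ → ι s Fin.≤ ι′ s
        raised s s≢j′ with s Fin.≟ j
        ... | yes refl = ιj≤ι′j
        ... | no s≢j   = ≤-reflexive (cong toℕ (sym (agrees s s≢j s≢j′)))

        increasing : ∀ t u → t Fin.< u → ι′ t Fin.< ι′ u
        increasing t u t<u with t Fin.≟ j | u Fin.≟ j′
        ... | yes refl | yes refl = ι′j<ι′j′
        ... | yes refl | no u≢j′  =
          <-trans ι′j<ι′j′ (≤-<-trans ι′j′≤ιj′ (<-≤-trans (ι-increasing j′ u j′<u) (raised u u≢j′)))
          where
            j′<u : j′ Fin.< u
            j′<u = ≤∧≢⇒< (subst (_≤ toℕ u) (sym j′≡1+j) t<u) (u≢j′ ∘ sym ∘ toℕ-injective)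
        ... | no t≢j   | yes refl =
          <-trans (≤-<-trans (lowered t t≢j) (<-≤-trans (ι-increasing t j t<j) ιj≤ι′j)) ι′j<ι′j′
          where
            t<j : t Fin.< j
            t<j = ≤∧≢⇒< (≤-pred (subst (toℕ t <_) j′≡1+j t<u)) (t≢j ∘ toℕ-injective)
        ... | no t≢j   | no u≢j′  =
          ≤-<-trans (lowered t t≢j) (<-≤-trans (ι-increasing t u t<u) (raised u u≢j′))

⟨$⟩ʳ-injective : ∀ {n} (σ : Perm n) {x y} → σ ⟨$⟩ʳ x ≡ σ ⟨$⟩ʳ y → x ≡ y
⟨$⟩ʳ-injective σ eq = trans (sym (inverseˡ σ)) (trans (cong (σ ⟨$⟩ˡ_) eq) (inverseˡ σ))

pos-suc : ∀ {n k} (ι : Fin k → Fin n) (t : Fin k) → pos ι (suc (toℕ t)) ≡ suc (toℕ (ι t))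
pos-suc {k = k} ι t with toℕ t <? k
... | yes t<k = cong (λ s → suc (toℕ (ι s))) (fromℕ<-toℕ t t<k)
... | no t≮k  = contradiction (toℕ<n t) t≮k

val-suc : ∀ {n k} (π : Perm n) (p : Perm k) (ι : Fin k → Fin n) (r : Fin k)
        → val π p ι (suc (toℕ r)) ≡ suc (toℕ (π ⟨$⟩ʳ ι (p ⟨$⟩ˡ r)))
val-suc {k = k} π p ι r with toℕ r <? k
... | yes r<k = cong (λ s → suc (toℕ (π ⟨$⟩ʳ ι (p ⟨$⟩ˡ s)))) (fromℕ<-toℕ r r<k)
... | no r≮k  = contradiction (toℕ<n r) r≮k

∈-middle : ∀ {k} (y : Fin (suc k)) → 2 ≤ toℕ y → toℕ y ≤ k ∸ 2 → y ∈ middle k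
∈-middle {k} y 2≤y y≤k∸2 =
  lookup⇒[]= y (middle k) (trans (lookup∘tabulate member y) (chosen (2 ≤? toℕ y) (toℕ y ≤? k ∸ 2)))
  where
    member : Fin (suc k) → Bool
    member z = if ⌊ 2 ≤? toℕ z ⌋ ∧ ⌊ toℕ z ≤? k ∸ 2 ⌋ then inside else outside

    chosen : (lower? : Dec (2 ≤ toℕ y)) (upper? : Dec (toℕ y ≤ k ∸ 2))
           → (if ⌊ lower? ⌋ ∧ ⌊ upper? ⌋ then inside else outside) ≡ inside
    chosen (yes _)     (yes _)     = refl
    chosen (no 2≰y)    _           = contradiction 2≤y 2≰y
    chosen (yes _)     (no y≰k∸2)  = contradiction y≤k∸2 y≰k∸2

-- The value of π at a 0-based position; positions c ≥ n get the junk value 0.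
value : ∀ {n} → Perm n → ℕ → ℕ
value {n} π c with c <? n
... | yes c<n = toℕ (π ⟨$⟩ʳ fromℕ< c<n)
... | no _    = 0

value-fromℕ< : ∀ {n} (π : Perm n) {c} (c<n : c < n) → value π c ≡ toℕ (π ⟨$⟩ʳ fromℕ< c<n)
value-fromℕ< {n} π {c} c<n with c <? n
... | yes _   = refl
... | no c≮n  = contradiction c<n c≮n

value-toℕ : ∀ {n} (π : Perm n) (x : Fin n) → value π (toℕ x) ≡ toℕ (π ⟨$⟩ʳ x)
value-toℕ π x = trans (value-fromℕ< π (toℕ<n x)) (cong (λ y → toℕ (π ⟨$⟩ʳ y)) (fromℕ<-toℕ x (toℕ<n x)))

module AdjacentExtremes {m n : ℕ} (p : Perm (2 + m)) (j j′ : Fin (2 + m))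
  (p[j]≡max : toℕ (p ⟨$⟩ʳ j) ≡ suc m) (j′≡1+j : toℕ j′ ≡ suc (toℕ j)) (p[j′]≡0 : toℕ (p ⟨$⟩ʳ j′) ≡ 0)
  (π : Perm n) (ι : Fin (2 + m) → Fin n) (occ : IsOccurrence ⟨ p , ∅ , middle (2 + m) ⟩ π ι)
  where
  open IsOccurrence occ

  P V : Fin (2 + m) → ℕ
  P t = toℕ (p ⟨$⟩ʳ t)
  V t = toℕ (π ⟨$⟩ʳ ι t)

  P-injective : ∀ {t u} → P t ≡ P u → t ≡ u
  P-injective = ⟨$⟩ʳ-injective p ∘ toℕ-injective

  V-preserving : ∀ t u → P t < P u → V t < V u
  V-preserving t u = proj₂ (order-iso t u)

  V-monotone : ∀ t u → P t ≤ P u → V t ≤ V u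
  V-monotone t u Pt≤Pu with m≤n⇒m<n∨m≡n Pt≤Pu
  ... | inj₁ Pt<Pu = <⇒≤ (V-preserving t u Pt<Pu)
  ... | inj₂ Pt≡Pu = ≤-reflexive (cong V (P-injective Pt≡Pu))

  P≤P[j] : ∀ t → P t ≤ P j
  P≤P[j] t = subst (P t ≤_) (sym p[j]≡max) (≤-pred (toℕ<n (p ⟨$⟩ʳ t)))

  P[j′]≤P : ∀ t → P j′ ≤ P t
  P[j′]≤P t = subst (_≤ P t) (sym p[j′]≡0) z≤n

  j≢j′ : j ≢ j′
  j≢j′ refl = 1+n≢n (sym j′≡1+j)

  j<j′ : j Fin.< j′
  j<j′ = subst (toℕ j <_) (sym j′≡1+j) (n<1+n (toℕ j))

  inner-rank : ∀ t → t ≢ j → t ≢ j′ → 1 ≤ P t × P t ≤ m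
  inner-rank t t≢j t≢j′ =
      n≢0⇒n>0 (t≢j′ ∘ P-injective ∘ λ Pt≡0 → trans Pt≡0 (sym p[j′]≡0))
    , ≤-pred (subst (P t <_) p[j]≡max (≤∧≢⇒< (P≤P[j] t) (t≢j ∘ P-injective)))

  -- L is the value matched to the letter 2 of p, the smallest inner letter.
  L : ℕ
  L = V (p ⟨$⟩ˡ suc zero)

  L≤V : ∀ t → 1 ≤ P t → L ≤ V t
  L≤V t 1≤Pt = V-monotone _ t (subst (_≤ P t) (sym (cong toℕ (inverseʳ p))) 1≤Pt)

  L≤V[j] : L ≤ V j
  L≤V[j] = L≤V j (subst (1 ≤_) (sym p[j]≡max) (s≤s z≤n))

  V[j′]<L : V j′ < L
  V[j′]<L = V-preserving j′ _ (subst₂ _<_ (sym p[j′]≡0) (sym (cong toℕ (inverseʳ p))) (s≤s z≤n))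

  -- W r is the 1-based value matched to the 0-based letter r of p, as in val.
  W : ℕ → ℕ
  W r = val π p ι (suc r)

  W-step : ∀ r → 1 ≤ r → suc r ≤ m → W (suc r) ≡ suc (W r)
  W-step r 1≤r 1+r≤m =
    subst (λ z → val π p ι (suc z) ≡ suc (val π p ι z)) (toℕ-fromℕ< 1+r<3+m)
      (adjY y (∈-middle y (subst (2 ≤_) (sym (toℕ-fromℕ< 1+r<3+m)) (s≤s 1≤r))
                          (subst (_≤ m) (sym (toℕ-fromℕ< 1+r<3+m)) 1+r≤m)))
    where
      1+r<3+m : suc r < suc (2 + m)
      1+r<3+m = s≤s (m≤n⇒m≤1+n (m≤n⇒m≤1+n 1+r≤m))
      y : Fin (suc (2 + m))
      y = fromℕ< 1+r<3+m

  W-P : ∀ t → W (P t) ≡ suc (V t)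
  W-P t = trans (val-suc π p ι (p ⟨$⟩ʳ t)) (cong (λ s → suc (toℕ (π ⟨$⟩ʳ ι s))) (inverseˡ p))

  inner-values-taken : ∀ t → t ≢ j → t ≢ j′ → ∀ {v} → L ≤ v → v ≤ V t → ∃[ s ] V s ≡ v
  inner-values-taken t t≢j t≢j′ {v} L≤v v≤Vt
    with inner-rank t t≢j t≢j′
  ... | 1≤Pt , Pt≤m
    with run-covers W (P t) 1≤Pt (λ r 1≤r r<Pt → W-step r 1≤r (≤-trans r<Pt Pt≤m))
           (subst (_≤ suc v) (sym (val-suc π p ι (suc zero))) (s≤s L≤v))
           (subst (suc v ≤_) (sym (W-P t)) (s≤s v≤Vt))
  ... | r , r≤Pt , Wr≡1+v =
    p ⟨$⟩ˡ fromℕ< r<k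
    , suc-injective (trans (sym (val-suc π p ι (fromℕ< r<k))) (trans (cong W (toℕ-fromℕ< r<k)) Wr≡1+v))
    where
      r<k : r < 2 + m
      r<k = ≤-<-trans r≤Pt (toℕ<n (p ⟨$⟩ʳ t))

  between-above-inner : ∀ (x : Fin n) → ι j Fin.< x → x Fin.< ι j′ → L ≤ toℕ (π ⟨$⟩ʳ x)
                      → ∀ t → t ≢ j → t ≢ j′ → V t < toℕ (π ⟨$⟩ʳ x)
  between-above-inner x ιj<x x<ιj′ L≤πx t t≢j t≢j′ with V t <? toℕ (π ⟨$⟩ʳ x)
  ... | yes Vt<πx = Vt<πx
  ... | no Vt≮πx with inner-values-taken t t≢j t≢j′ L≤πx (≮⇒≥ Vt≮πx)
  ...   | s , Vs≡πx with ⟨$⟩ʳ-injective π (toℕ-injective Vs≡πx)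
  ...     | refl = contradiction (increasing-adjacent-gap increasing j′≡1+j s ιj<x) (<⇒≱ x<ιj′)

  module AtDescent (c : ℕ) (ι[j]≤c : toℕ (ι j) ≤ c) (c<ι[j′] : c < toℕ (ι j′))
                   (L≤π[c] : L ≤ value π c) (π[1+c]<L : value π (suc c) < L) where

    c<n : c < n
    c<n = <-trans c<ι[j′] (toℕ<n (ι j′))

    1+c<n : suc c < n
    1+c<n = ≤-<-trans c<ι[j′] (toℕ<n (ι j′))

    ι′ : Fin (2 + m) → Fin n
    ι′ = updateAt (updateAt ι j (const (fromℕ< c<n))) j′ (const (fromℕ< 1+c<n))

    ι′-agrees : ∀ t → t ≢ j → t ≢ j′ → ι′ t ≡ ι t
    ι′-agrees t t≢j t≢j′ = trans (updateAt-minimal t j′ _ t≢j′) (updateAt-minimal t j ι t≢j)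

    ι′[j] : ι′ j ≡ fromℕ< c<n
    ι′[j] = trans (updateAt-minimal j j′ _ j≢j′) (updateAt-updates j ι)

    ι′[j′] : ι′ j′ ≡ fromℕ< 1+c<n
    ι′[j′] = updateAt-updates j′ _

    toℕ-ι′[j] : toℕ (ι′ j) ≡ c
    toℕ-ι′[j] = trans (cong toℕ ι′[j]) (toℕ-fromℕ< c<n)

    toℕ-ι′[j′] : toℕ (ι′ j′) ≡ suc c
    toℕ-ι′[j′] = trans (cong toℕ ι′[j′]) (toℕ-fromℕ< 1+c<n)

    V′ : Fin (2 + m) → ℕ
    V′ t = toℕ (π ⟨$⟩ʳ ι′ t)

    V′-agrees : ∀ t → t ≢ j → t ≢ j′ → V′ t ≡ V t
    V′-agrees t t≢j t≢j′ = cong (λ x → toℕ (π ⟨$⟩ʳ x)) (ι′-agrees t t≢j t≢j′)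

    L≤V′[j] : L ≤ V′ j
    L≤V′[j] = subst (L ≤_) (trans (value-fromℕ< π c<n) (cong (λ x → toℕ (π ⟨$⟩ʳ x)) (sym ι′[j]))) L≤π[c]

    V′[j′]<L : V′ j′ < L
    V′[j′]<L = subst (_< L) (trans (value-fromℕ< π 1+c<n) (cong (λ x → toℕ (π ⟨$⟩ʳ x)) (sym ι′[j′]))) π[1+c]<L

    inner-below-V′[j] : ∀ t → t ≢ j → t ≢ j′ → V t < V′ j
    inner-below-V′[j] t t≢j t≢j′ with m≤n⇒m<n∨m≡n ι[j]≤c
    ... | inj₁ ι[j]<c =
      between-above-inner (ι′ j) (subst (toℕ (ι j) <_) (sym toℕ-ι′[j]) ι[j]<c)
        (subst (_< toℕ (ι j′)) (sym toℕ-ι′[j]) c<ι[j′]) L≤V′[j] t t≢j t≢j′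
    ... | inj₂ ι[j]≡c =
      subst (λ x → V t < toℕ (π ⟨$⟩ʳ x)) (toℕ-injective (trans ι[j]≡c (sym toℕ-ι′[j])))
        (V-preserving t j (≤∧≢⇒< (P≤P[j] t) (t≢j ∘ P-injective)))

    inner-between : ∀ t → t ≢ j → t ≢ j′ → V′ j′ < V′ t × V′ t < V′ j
    inner-between t t≢j t≢j′ rewrite V′-agrees t t≢j t≢j′ =
      <-≤-trans V′[j′]<L (L≤V t (proj₁ (inner-rank t t≢j t≢j′))) , inner-below-V′[j] t t≢j t≢j′

    V′-preserving : ∀ t u → P t < P u → V′ t < V′ u
    V′-preserving = replace-extremes-preserving P V V′ P≤P[j] P[j′]≤P V-preserving
                      V′-agrees (<-≤-trans V′[j′]<L L≤V′[j]) inner-between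

    adjacent : pos ι′ (suc (suc (toℕ j))) ≡ suc (pos ι′ (suc (toℕ j)))
    adjacent = begin
      pos ι′ (suc (suc (toℕ j)))  ≡⟨ cong (pos ι′ ∘ suc) j′≡1+j ⟨
      pos ι′ (suc (toℕ j′))       ≡⟨ pos-suc ι′ j′ ⟩
      suc (toℕ (ι′ j′))           ≡⟨ cong suc toℕ-ι′[j′] ⟩
      suc (suc c)                 ≡⟨ cong (λ z → suc (suc z)) toℕ-ι′[j] ⟨
      suc (suc (toℕ (ι′ j)))      ≡⟨ cong suc (pos-suc ι′ j) ⟨
      suc (pos ι′ (suc (toℕ j)))  ∎
      where open ≡-Reasoning

    occurrence : IsOccurrence ⟨ p , ⁅ suc j ⁆ , ∅ ⟩ π ι′
    occurrence = record
      { increasing = replace-adjacent-increasing increasing j′≡1+j ι′-agrees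
                       (subst (toℕ (ι j) ≤_) (sym toℕ-ι′[j]) ι[j]≤c)
                       (subst₂ _<_ (sym toℕ-ι′[j]) (sym toℕ-ι′[j′]) (n<1+n c))
                       (subst (_≤ toℕ (ι j′)) (sym toℕ-ι′[j′]) c<ι[j′])
      ; order-iso  = λ t u → <-preserving⇒<-reflecting P V′ P-injective V′-preserving t u , V′-preserving t u
      ; adjX       = λ x x∈⁅1+j⁆ → subst (λ y → pos ι′ (suc (toℕ y)) ≡ suc (pos ι′ (toℕ y)))
                                         (sym (x∈⁅y⁆⇒x≡y (suc j) x∈⁅1+j⁆)) adjacent
      ; adjY       = λ _ y∈∅ → contradiction y∈∅ ∉⊥
      }

  adjacent-occurrence : ∃[ ι′ ] IsOccurrence ⟨ p , ⁅ suc j ⁆ , ∅ ⟩ π ι′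
  adjacent-occurrence
    with crossing (value π) (toℕ (ι j′)) (<⇒≤ (increasing j j′ j<j′))
           (subst (L ≤_) (sym (value-toℕ π (ι j))) L≤V[j])
           (subst (_< L) (sym (value-toℕ π (ι j′))) V[j′]<L)
  ... | c , ι[j]≤c , c<ι[j′] , L≤π[c] , π[1+c]<L =
    AtDescent.ι′ c ι[j]≤c c<ι[j′] L≤π[c] π[1+c]<L , AtDescent.occurrence c ι[j]≤c c<ι[j′] L≤π[c] π[1+c]<L

corollary1 : (k : ℕ) → 2 ≤ k → (p : Perm k) → (j j′ : Fin k)
    → toℕ (p ⟨$⟩ʳ j) ≡ k ∸ 1
    → toℕ j′ ≡ suc (toℕ j)
    → toℕ (p ⟨$⟩ʳ j′) ≡ 0
    → (n : ℕ) → (π : Perm n)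
    → Avoids π ⟨ p , ⁅ suc j ⁆ , ∅ ⟩
    → Avoids π ⟨ p , ∅ , middle k ⟩
corollary1 (suc (suc m)) _ p j j′ p[j]≡max j′≡1+j p[j′]≡0 n π avoids (ι , occ) =
  avoids (AdjacentExtremes.adjacent-occurrence p j j′ p[j]≡max j′≡1+j p[j′]≡0 π ι occ)
corollary1 (suc zero) (s≤s ())
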